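{- Let $f(n)$ denote the number of partitions of $n$ in which the nonzero multiplicities of the distinct parts are pairwise different. Then $$\ln f(n)\le (1+o(1))\,\frac{6^{1/3}}{3}\,n^{1/3}\ln n \qquad\text{as } n\to\infty.$$
   Context: A partition of $n$ can be written as $n=m_1p_1+\cdots+m_rp_r$ where $p_1<\cdots<p_r$ are the distinct parts and $m_i\ge1$ is the multiplicity of $p_i$; $f(n)$ counts those with $m_1,\dots,m_r$ pairwise distinct. -}

module Defs where

open import Data.Nat using (ℕ; zero; suc; _+_; _*_; _<ᵇ_; _≡ᵇ_)
open import Data.Bool using (Bool; true; false; _∧_; not; T)
open import Data.List using (List; []; _∷_; map)
open import Data.Bool.ListAction using (all; any)
open import Data.Product using (_×_; _,_; proj₂; Σ)

-- A partition of n is encoded by the list of pairs (p_i , m_i) of its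
-- distinct parts p_1 < ... < p_r with their multiplicities m_i ≥ 1,
-- so that n = m_1 p_1 + ... + m_r p_r.

increasing : List (ℕ × ℕ) → Bool
increasing [] = true
increasing (_ ∷ []) = true
increasing ((p , _) ∷ (p' , m') ∷ r) = (p <ᵇ p') ∧ increasing ((p' , m') ∷ r)

positive : List (ℕ × ℕ) → Bool
positive = all (λ { (p , m) → (0 <ᵇ p) ∧ (0 <ᵇ m) })

distinct : List ℕ → Bool
distinct [] = true
distinct (x ∷ xs) = not (any (λ y → x ≡ᵇ y) xs) ∧ distinct xs

weight : List (ℕ × ℕ) → ℕ
weight [] = 0
weight ((p , m) ∷ r) = m * p + weight r

isDMPartition : ℕ → List (ℕ × ℕ) → Bool
isDMPartition n l = increasing l ∧ positive l ∧ distinct (map proj₂ l) ∧ (weight l ≡ᵇ n)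

DMPartition : ℕ → Set
DMPartition n = Σ (List (ℕ × ℕ)) (λ l → T (isDMPartition n l))

{-# OPTIONS --safe #-}
-- Write a partition with distinct parts p₁ < ⋯ < p_r and multiplicities m_i through its
-- gaps s_i = p_i − p_{i−1} ≥ 1.  Then n = Σ s_i (m_i + ⋯ + m_r), and as the multiplicities
-- are distinct each suffix sum is at least a triangular number: Σ T(r−i+1) s_i ≤ n.  Also
-- Σ i m_i ≤ n since p_i ≥ i.  Hence r(r+1)(r+2) ≤ 6n, and the partitions with r parts
-- inject into pairs of lattice points of two simplices, at most
-- n^r / (r! ∏ T(j)) · n^r / r!² = 2^r n^(2r) / (r!⁴ (r+1)!) of them.  This bound grows in r
-- up to y = ⌊(6n)^(1/3)⌋, so f(n) ≤ (y+1) 2^y n^(2y) / y!⁵, and y! ≥ (y/4)^y together with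
-- n ≤ (y+1)³ turns this into f(n)³ ≤ 2^(34y) n^y for large n.
module Submission where

open import Defs
open import Data.Nat using (ℕ; _+_; _*_; _^_; _≤_; _<_)
open import Data.Fin using (Fin)
open import Data.Product using (∃-syntax)
open import Function.Bundles using (_↔_)

open import Data.Nat
open import Data.Nat.Properties
open import Data.Nat.ListAction using (sum; product)
open import Data.Nat.Tactic.RingSolver using (solve-∀)
open import Data.Bool using (T; _∧_; not)
open import Data.Bool.ListAction using (any)
open import Data.Bool.Properties using (T-∧; T-not-≡; T-irrelevant)
open import Data.Fin.Properties using (injective⇒≤)
open import Data.List using (List; []; _∷_; [_]; map; _++_; length; iterate; applyDownFrom; cartesianProductWith; lookup)
open import Data.List.Properties using (length-++; length-map; length-applyDownFrom)
open import Data.List.Relation.Unary.All as All using (All; []; _∷_)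
open import Data.List.Relation.Unary.All.Properties using (¬Any⇒All¬)
open import Data.List.Relation.Unary.Any as Any using (here; index)
open import Data.List.Relation.Unary.Any.Properties using (any⁺; lookup-index)
open import Data.List.Relation.Unary.Unique.Propositional using (Unique; []; _∷_)
open import Data.List.Membership.Propositional using (_∈_)
open import Data.List.Membership.Propositional.Properties using (∈-map⁺; ∈-++⁺ˡ; ∈-++⁺ʳ; ∈-cartesianProductWith⁺)
open import Data.Product using (_×_; _,_; proj₁; proj₂)
open import Data.Sum using (_⊎_; inj₁; inj₂)
open import Data.Empty using (⊥-elim)
open import Function using (_∘_)
open import Function.Bundles using (Equivalence; Inverse)
open import Relation.Nullary using (yes; no; ¬_)
open import Algebra.Properties.CommutativeSemigroup *-commutativeSemigroup as *-CS using ()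
open import Algebra.Properties.CommutativeSemigroup +-commutativeSemigroup as +-CS using ()
open import Relation.Binary.PropositionalEquality using (_≡_; refl; sym; trans; cong; cong₂; subst; subst₂; module ≡-Reasoning)

-- Powers and factorials

^-distribʳ-* : ∀ m n o → (m * n) ^ o ≡ m ^ o * n ^ o
^-distribʳ-* m n zero    = refl
^-distribʳ-* m n (suc o) = begin
  m * n * (m * n) ^ o     ≡⟨ cong (m * n *_) (^-distribʳ-* m n o) ⟩
  m * n * (m ^ o * n ^ o) ≡⟨ [m*n]*[o*p]≡[m*o]*[n*p] m n (m ^ o) (n ^ o) ⟩
  m ^ suc o * n ^ suc o   ∎
  where open ≡-Reasoning

[m*n*o]^p≡m^p*n^p*o^p : ∀ m n o p → (m * n * o) ^ p ≡ m ^ p * n ^ p * o ^ p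
[m*n*o]^p≡m^p*n^p*o^p m n o p = trans (^-distribʳ-* (m * n) o p) (cong (_* o ^ p) (^-distribʳ-* m n p))

^-cancelʳ-≤ : ∀ {m o} n .{{_ : NonZero n}} → m ^ n ≤ o ^ n → m ≤ o
^-cancelʳ-≤ {m} {o} n mⁿ≤oⁿ with m ≤? o
... | yes m≤o = m≤o
... | no  m≰o = ⊥-elim (<⇒≱ (^-monoˡ-< n (≰⇒> m≰o)) mⁿ≤oⁿ)

^-cancelʳ-< : ∀ {m o} n → m ^ n < o ^ n → m < o
^-cancelʳ-< {m} {o} n mⁿ<oⁿ with m <? o
... | yes m<o = m<o
... | no  m≮o = ⊥-elim (<⇒≱ mⁿ<oⁿ (^-monoˡ-≤ n (≮⇒≥ m≮o)))

m≤m^n : ∀ m n .{{_ : NonZero m}} .{{_ : NonZero n}} → m ≤ m ^ n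
m≤m^n m (suc n) = m≤m*n m (m ^ n) {{m^n≢0 m n}}

[m^n]^o≡[m^o]^n : ∀ m n o → (m ^ n) ^ o ≡ (m ^ o) ^ n
[m^n]^o≡[m^o]^n m n o = begin
  (m ^ n) ^ o ≡⟨ ^-*-assoc m n o ⟩
  m ^ (n * o) ≡⟨ cong (m ^_) (*-comm n o) ⟩
  m ^ (o * n) ≡⟨ ^-*-assoc m o n ⟨
  (m ^ o) ^ n ∎
  where open ≡-Reasoning

bernoulli : ∀ d a w → a ^ suc d + suc d * w * a ^ d ≤ (a + w) ^ suc d
bernoulli zero a w = ≤-reflexive (base a w)
  where
  base : ∀ a w → a * 1 + 1 * w * 1 ≡ (a + w) * 1
  base = solve-∀
bernoulli (suc d) a w = begin
  a * (a * A) + (2 + d) * w * (a * A)                  ≤⟨ m≤m+n _ (suc d * w * w * A) ⟩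
  a * (a * A) + (2 + d) * w * (a * A) + suc d * w * w * A ≡⟨ expand a w A d ⟩
  (a + w) * (a * A + suc d * w * A)                    ≤⟨ *-monoʳ-≤ (a + w) (bernoulli d a w) ⟩
  (a + w) ^ (2 + d)                                    ∎
  where
  open ≤-Reasoning
  A = a ^ d
  expand : ∀ a w A d → a * (a * A) + (2 + d) * w * (a * A) + suc d * w * w * A
                     ≡ (a + w) * (a * A + suc d * w * A)
  expand = solve-∀

-- (1 + 1/(1+k))^(2+k) ≤ (1 + 1/k)^(1+k), cleared of denominators.
[1+1/k]^[1+k]-antitone : ∀ k → (2 + k) ^ (2 + k) * k ^ (1 + k) ≤ (1 + k) * ((1 + k) * (1 + k)) ^ (1 + k)
[1+1/k]^[1+k]-antitone k = begin
  (2 + k) ^ (2 + k) * k ^ (1 + k)   ≡⟨ *-assoc (2 + k) ((2 + k) ^ (1 + k)) _ ⟩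
  (2 + k) * ((2 + k) ^ (1 + k) * k ^ (1 + k))
    ≡⟨ cong ((2 + k) *_) (trans (cong (_^ (1 + k)) (*-comm k (2 + k))) (^-distribʳ-* (2 + k) k (1 + k))) ⟨
  (2 + k) * (a * A)                 ≤⟨ m≤m+n _ A ⟩
  (2 + k) * (a * A) + A             ≡⟨ regroup k A ⟩
  (1 + k) * (a * A + (1 + k) * 1 * A) ≤⟨ *-monoʳ-≤ (1 + k) (bernoulli k a 1) ⟩
  (1 + k) * (a + 1) ^ (1 + k)       ≡⟨ cong (λ b → (1 + k) * b ^ (1 + k)) (square k) ⟩
  (1 + k) * ((1 + k) * (1 + k)) ^ (1 + k) ∎
  where
  open ≤-Reasoning
  a = k * (2 + k)
  A = a ^ k
  regroup : ∀ k A → (2 + k) * (k * (2 + k) * A) + A ≡ (1 + k) * (k * (2 + k) * A + (1 + k) * 1 * A)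
  regroup = solve-∀
  square : ∀ k → k * (2 + k) + 1 ≡ (1 + k) * (1 + k)
  square = solve-∀

[2+k]^[2+k]≤4*[1+k]^[2+k] : ∀ k → (2 + k) ^ (2 + k) ≤ 4 * (1 + k) ^ (2 + k)
[2+k]^[2+k]≤4*[1+k]^[2+k] zero    = ≤-refl
[2+k]^[2+k]≤4*[1+k]^[2+k] (suc j) = *-cancelʳ-≤ _ _ (K ^ (1 + K)) {{m^n≢0 K (1 + K)}} (begin
  (2 + K) ^ (2 + K) * K ^ (1 + K)     ≤⟨ [1+1/k]^[1+k]-antitone K ⟩
  (1 + K) * ((1 + K) * (1 + K)) ^ (1 + K)
    ≡⟨ cong ((1 + K) *_) (^-distribʳ-* (1 + K) (1 + K) (1 + K)) ⟩
  (1 + K) * ((1 + K) ^ (1 + K) * (1 + K) ^ (1 + K))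
    ≡⟨ *-CS.x∙yz≈y∙xz (1 + K) ((1 + K) ^ (1 + K)) ((1 + K) ^ (1 + K)) ⟩
  (1 + K) ^ (1 + K) * (1 + K) ^ (2 + K) ≤⟨ *-monoˡ-≤ _ ([2+k]^[2+k]≤4*[1+k]^[2+k] j) ⟩
  4 * K ^ (1 + K) * (1 + K) ^ (2 + K)   ≡⟨ *-CS.xy∙z≈xz∙y 4 (K ^ (1 + K)) ((1 + K) ^ (2 + K)) ⟩
  4 * (1 + K) ^ (2 + K) * K ^ (1 + K)   ∎)
  where
  open ≤-Reasoning
  K = suc j

[1+k]^k≤4*k^k : ∀ k → (1 + k) ^ k ≤ 4 * k ^ k
[1+k]^k≤4*k^k zero    = s≤s z≤n
[1+k]^k≤4*k^k (suc j) = *-cancelˡ-≤ (2 + j) (begin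
  (2 + j) * (2 + j) ^ (1 + j)     ≤⟨ [2+k]^[2+k]≤4*[1+k]^[2+k] j ⟩
  4 * ((1 + j) * (1 + j) ^ (1 + j)) ≤⟨ *-monoʳ-≤ 4 (*-monoˡ-≤ ((1 + j) ^ (1 + j)) (n≤1+n (1 + j))) ⟩
  4 * ((2 + j) * (1 + j) ^ (1 + j)) ≡⟨ *-CS.x∙yz≈y∙xz 4 (2 + j) ((1 + j) ^ (1 + j)) ⟩
  (2 + j) * (4 * (1 + j) ^ (1 + j)) ∎)
  where open ≤-Reasoning

k^k≤4^k*k! : ∀ k → k ^ k ≤ 4 ^ k * k !
k^k≤4^k*k! zero    = ≤-refl
k^k≤4^k*k! (suc k) = begin
  (1 + k) * (1 + k) ^ k             ≤⟨ *-monoʳ-≤ (1 + k) ([1+k]^k≤4*k^k k) ⟩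
  (1 + k) * (4 * k ^ k)             ≤⟨ *-monoʳ-≤ (1 + k) (*-monoʳ-≤ 4 (k^k≤4^k*k! k)) ⟩
  (1 + k) * (4 * (4 ^ k * k !))     ≡⟨ regroup (1 + k) (4 ^ k) (k !) ⟩
  4 * 4 ^ k * ((1 + k) * k !)       ∎
  where
  open ≤-Reasoning
  regroup : ∀ x a b → x * (4 * (a * b)) ≡ 4 * a * (x * b)
  regroup = solve-∀

-- Lattice points in a simplex

dot : List ℕ → List ℕ → ℕ
dot (w ∷ ws) (x ∷ xs) = w * x + dot ws xs
dot _        _        = 0

incrementHead : List ℕ → List ℕ
incrementHead []       = []
incrementHead (x ∷ xs) = suc x ∷ xs

-- simplex ws n lists the vectors xs of positive integers with dot ws xs ≤ n (∈-simplex);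
-- simplexByHead enumerates those of the form x ∷ xs by their head x ≥ 1, which the fuel bounds.
mutual
  simplex : List ℕ → ℕ → List (List ℕ)
  simplex []       n = [ [] ]
  simplex (w ∷ ws) n = simplexByHead n w ws n

  simplexByHead : ℕ → ℕ → List ℕ → ℕ → List (List ℕ)
  simplexByHead zero       w ws n = []
  simplexByHead (suc fuel) w ws n with w ≤? n
  ... | yes _ = map (1 ∷_) (simplex ws (n ∸ w)) ++ map incrementHead (simplexByHead fuel w ws (n ∸ w))
  ... | no  _ = []

-- Splitting off the head 1 leaves a simplex of size n ∸ w, and the remaining points
-- form a copy of the whole set for n ∸ w; Bernoulli's inequality closes the induction.
length-simplexByHead : ∀ fuel w ws n c → (∀ m → length (simplex ws m) * c ≤ m ^ length ws) →
                       length (simplexByHead fuel w ws n) * (suc (length ws) * w * c) ≤ n ^ suc (length ws)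
length-simplexByHead zero       w ws n c bound = z≤n
length-simplexByHead (suc fuel) w ws n c bound with w ≤? n
... | no  _   = z≤n
... | yes w≤n = begin
  length (map (1 ∷_) (simplex ws a) ++ map incrementHead (simplexByHead fuel w ws a)) * K
    ≡⟨ cong (_* K) (trans (length-++ (map (1 ∷_) (simplex ws a)))
                          (cong₂ _+_ (length-map _ (simplex ws a)) (length-map _ (simplexByHead fuel w ws a)))) ⟩
  (length (simplex ws a) + length (simplexByHead fuel w ws a)) * K
    ≡⟨ distribute (length (simplex ws a)) (length (simplexByHead fuel w ws a)) (suc d) w c ⟩
  suc d * w * (length (simplex ws a) * c) + length (simplexByHead fuel w ws a) * K
    ≤⟨ +-mono-≤ (*-monoʳ-≤ (suc d * w) (bound a)) (length-simplexByHead fuel w ws a c bound) ⟩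
  suc d * w * a ^ d + a ^ suc d       ≡⟨ +-comm (suc d * w * a ^ d) _ ⟩
  a ^ suc d + suc d * w * a ^ d       ≤⟨ bernoulli d a w ⟩
  (a + w) ^ suc d                     ≡⟨ cong (_^ suc d) (m∸n+n≡m w≤n) ⟩
  n ^ suc d                           ∎
  where
  open ≤-Reasoning
  a = n ∸ w
  d = length ws
  K = suc d * w * c
  distribute : ∀ s t e w c → (s + t) * (e * w * c) ≡ e * w * (s * c) + t * (e * w * c)
  distribute = solve-∀

length-simplex : ∀ ws n → All (1 ≤_) ws → length (simplex ws n) * (length ws ! * product ws) ≤ n ^ length ws
length-simplex []       n []       = ≤-refl
length-simplex (w ∷ ws) n (_ ∷ ws⁺) = begin
  length (simplexByHead n w ws n) * ((1 + d) ! * (w * product ws))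
    ≡⟨ cong (length (simplexByHead n w ws n) *_) (regroup (1 + d) (d !) w (product ws)) ⟩
  length (simplexByHead n w ws n) * ((1 + d) * w * (d ! * product ws))
    ≤⟨ length-simplexByHead n w ws n (d ! * product ws) (λ m → length-simplex ws m ws⁺) ⟩
  n ^ (1 + d) ∎
  where
  open ≤-Reasoning
  d = length ws
  regroup : ∀ e f w p → e * f * (w * p) ≡ e * w * (f * p)
  regroup = solve-∀

m+n≤o⇒n≤o∸m : ∀ m {n o} → m + n ≤ o → n ≤ o ∸ m
m+n≤o⇒n≤o∸m m {n} {o} m+n≤o = m+n≤o⇒m≤o∸n n (subst (_≤ o) (+-comm m n) m+n≤o)

∈-simplexByHead : ∀ fuel w ws x xs n → 1 ≤ w → 1 ≤ x → n ≤ fuel → w * x + dot ws xs ≤ n →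
                  (∀ m → dot ws xs ≤ m → xs ∈ simplex ws m) → (x ∷ xs) ∈ simplexByHead fuel w ws n
∈-simplexByHead zero w ws (suc x) xs n 1≤w _ n≤0 wx≤n _ =
  ⊥-elim (<⇒≱ (≤-trans 1≤w (m≤m*n w (suc x))) (≤-trans (m+n≤o⇒m≤o (w * suc x) wx≤n) n≤0))
∈-simplexByHead (suc fuel) w ws (suc x) xs n 1≤w _ n≤fuel wx≤n xs∈ with w ≤? n
... | no w≰n = ⊥-elim (w≰n (≤-trans (m≤m*n w (suc x)) (m+n≤o⇒m≤o (w * suc x) wx≤n)))
∈-simplexByHead (suc fuel) w ws 1 xs n 1≤w _ n≤fuel wx≤n xs∈ | yes _ =
  ∈-++⁺ˡ (∈-map⁺ (1 ∷_) (xs∈ (n ∸ w) (m+n≤o⇒n≤o∸m w (subst (λ v → v + dot ws xs ≤ n) (*-identityʳ w) wx≤n))))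
∈-simplexByHead (suc fuel) w ws (suc (suc x)) xs n 1≤w _ n≤fuel wx≤n xs∈ | yes _ =
  ∈-++⁺ʳ (map (1 ∷_) (simplex ws (n ∸ w)))
    (∈-map⁺ incrementHead
      (∈-simplexByHead fuel w ws (suc x) xs (n ∸ w) 1≤w (s≤s z≤n)
        (≤-trans (∸-monoʳ-≤ n 1≤w) (∸-monoˡ-≤ 1 n≤fuel))
        (m+n≤o⇒n≤o∸m w (subst (_≤ n) (peel w x (dot ws xs)) wx≤n)) xs∈))
  where
  peel : ∀ w x d → w * (2 + x) + d ≡ w + (w * (1 + x) + d)
  peel = solve-∀

∈-simplex : ∀ ws xs n → length xs ≡ length ws → All (1 ≤_) ws → All (1 ≤_) xs → dot ws xs ≤ n → xs ∈ simplex ws n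
∈-simplex []       []       n _   _          _          _ = here refl
∈-simplex (w ∷ ws) (x ∷ xs) n len (1≤w ∷ ws⁺) (1≤x ∷ xs⁺) wx≤n =
  ∈-simplexByHead n w ws x xs n 1≤w 1≤x ≤-refl wx≤n (λ m → ∈-simplex ws xs m (suc-injective len) ws⁺ xs⁺)

-- Sums of distinct positive numbers

triangle : ℕ → ℕ
triangle zero    = 0
triangle (suc r) = suc r + triangle r

below : ℕ → List ℕ → List ℕ
below B []       = []
below B (x ∷ xs) with x <? B
... | yes _ = x ∷ below B xs
... | no  _ = below B xs

below-all : ∀ {P : ℕ → Set} B {xs} → All P xs → All P (below B xs)
below-all B []              = []
below-all B {x ∷ xs} (px ∷ pxs) with x <? B
... | yes _ = px ∷ below-all B pxs
... | no  _ = below-all B pxs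

below-< : ∀ B xs → All (_< B) (below B xs)
below-< B []       = []
below-< B (x ∷ xs) with x <? B
... | yes x<B = x<B ∷ below-< B xs
... | no  _   = below-< B xs

below-unique : ∀ B {xs} → Unique xs → Unique (below B xs)
below-unique B []                  = []
below-unique B {x ∷ xs} (x∉ ∷ xs!) with x <? B
... | yes _ = below-all B x∉ ∷ below-unique B xs!
... | no  _ = below-unique B xs!

below-id : ∀ B {xs} → All (_< B) xs → below B xs ≡ xs
below-id B []                    = refl
below-id B {x ∷ xs} (x<B ∷ xs<B) with x <? B
... | yes _   = cong (x ∷_) (below-id B xs<B)
... | no  x≮B = ⊥-elim (x≮B x<B)

-- Among distinct numbers bounded by B, the value B occurs at most once.
below-split : ∀ B xs → Unique xs → All (_≤ B) xs →
              (sum xs ≡ sum (below B xs) × length xs ≡ length (below B xs)) ⊎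
              (sum xs ≡ B + sum (below B xs) × length xs ≡ suc (length (below B xs)))
below-split B []       _          _            = inj₁ (refl , refl)
below-split B (x ∷ xs) (x∉ ∷ xs!) (x≤B ∷ xs≤B) with x <? B
... | yes _ with below-split B xs xs! xs≤B
...   | inj₁ (s≡ , l≡) = inj₁ (cong (x +_) s≡ , cong suc l≡)
...   | inj₂ (s≡ , l≡) = inj₂ (trans (cong (x +_) s≡) (+-CS.x∙yz≈y∙xz x B _) , cong suc l≡)
below-split B (x ∷ xs) (x∉ ∷ xs!) (x≤B ∷ xs≤B) | no x≮B =
  inj₂ (cong₂ _+_ x≡B (cong sum (sym xs≡)) , cong (suc ∘ length) (sym xs≡))
  where
  x≡B : x ≡ B
  x≡B = ≤-antisym x≤B (≮⇒≥ x≮B)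
  xs≡ : below B xs ≡ xs
  xs≡ = below-id B (All.zipWith (λ (y≤B , x≢y) → ≤∧≢⇒< y≤B (λ y≡B → x≢y (trans x≡B (sym y≡B)))) (xs≤B , x∉))

triangle≤sum-bounded : ∀ B xs → Unique xs → All (1 ≤_) xs → All (_≤ B) xs →
                       length xs ≤ B × triangle (length xs) ≤ sum xs
triangle≤sum-bounded zero    []       _   _          _          = z≤n , z≤n
triangle≤sum-bounded zero    (x ∷ xs) _   (1≤x ∷ _) (x≤0 ∷ _) = ⊥-elim (<⇒≱ 1≤x x≤0)
triangle≤sum-bounded (suc B) xs       xs! xs⁺       xs≤B       = split (below-split (suc B) xs xs! xs≤B)
  where
  ys = below (suc B) xs
  ih : length ys ≤ B × triangle (length ys) ≤ sum ys
  ih = triangle≤sum-bounded B ys (below-unique (suc B) xs!) (below-all (suc B) xs⁺) (All.map ≤-pred (below-< (suc B) xs))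
  split : (sum xs ≡ sum ys × length xs ≡ length ys) ⊎ (sum xs ≡ suc B + sum ys × length xs ≡ suc (length ys)) →
          length xs ≤ suc B × triangle (length xs) ≤ sum xs
  split (inj₁ (s≡ , l≡)) =
    subst (_≤ suc B) (sym l≡) (m≤n⇒m≤1+n (proj₁ ih)) ,
    subst₂ _≤_ (cong triangle (sym l≡)) (sym s≡) (proj₂ ih)
  split (inj₂ (s≡ , l≡)) =
    subst (_≤ suc B) (sym l≡) (s≤s (proj₁ ih)) ,
    subst₂ _≤_ (cong triangle (sym l≡)) (sym s≡) (+-mono-≤ (s≤s (proj₁ ih)) (proj₂ ih))

triangle≤sum : ∀ xs → Unique xs → All (1 ≤_) xs → triangle (length xs) ≤ sum xs
triangle≤sum xs xs! xs⁺ = proj₂ (triangle≤sum-bounded (sum xs) xs xs! xs⁺ (≤-sum xs))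
  where
  ≤-sum : ∀ xs → All (_≤ sum xs) xs
  ≤-sum []       = []
  ≤-sum (x ∷ xs) = m≤m+n x (sum xs) ∷ All.map (λ y≤ → ≤-trans y≤ (m≤n+m (sum xs) x)) (≤-sum xs)

2*triangle : ∀ r → 2 * triangle r ≡ r * suc r
2*triangle zero    = refl
2*triangle (suc r) = begin
  2 * (suc r + triangle r)       ≡⟨ *-distribˡ-+ 2 (suc r) (triangle r) ⟩
  2 * suc r + 2 * triangle r     ≡⟨ cong (2 * suc r +_) (2*triangle r) ⟩
  2 * suc r + r * suc r          ≡⟨ *-distribʳ-+ (suc r) 2 r ⟨
  suc (suc r) * suc r            ≡⟨ *-comm (suc (suc r)) (suc r) ⟩
  suc r * suc (suc r)            ∎
  where open ≡-Reasoning

-- Partitions with distinct multiplicities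

data Ascending : ℕ → List (ℕ × ℕ) → Set where
  []  : ∀ {lo} → Ascending lo []
  _∷_ : ∀ {lo p m l} → lo < p → Ascending p l → Ascending lo ((p , m) ∷ l)

multiplicities : List (ℕ × ℕ) → List ℕ
multiplicities = map proj₂

record IsDMPartition (n : ℕ) (l : List (ℕ × ℕ)) : Set where
  field
    ascending               : Ascending 0 l
    multiplicities-positive : All (1 ≤_) (multiplicities l)
    multiplicities-unique   : Unique (multiplicities l)
    weight≡n                : weight l ≡ n

T-∧⁻ : ∀ {x y} → T (x ∧ y) → T x × T y
T-∧⁻ = Equivalence.to T-∧

increasing⇒Ascending : ∀ {lo p m} l → lo < p → T (increasing ((p , m) ∷ l)) → Ascending lo ((p , m) ∷ l)
increasing⇒Ascending []              lo<p _   = lo<p ∷ []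
increasing⇒Ascending {p = p} ((p′ , m′) ∷ l) lo<p inc =
  let (p<p′ , inc′) = T-∧⁻ {p <ᵇ p′} inc in lo<p ∷ increasing⇒Ascending l (<ᵇ⇒< p p′ p<p′) inc′

positive⇒multiplicities-positive : ∀ l → T (positive l) → All (1 ≤_) (multiplicities l)
positive⇒multiplicities-positive []            _   = []
positive⇒multiplicities-positive ((p , m) ∷ l) pos =
  let (pm , pos′) = T-∧⁻ {(0 <ᵇ p) ∧ (0 <ᵇ m)} pos
  in <ᵇ⇒< 0 m (proj₂ (T-∧⁻ {0 <ᵇ p} pm)) ∷ positive⇒multiplicities-positive l pos′

distinct⇒Unique : ∀ xs → T (distinct xs) → Unique xs
distinct⇒Unique []       _   = []
distinct⇒Unique (x ∷ xs) dis =
  let (fresh , dis′) = T-∧⁻ {not (any (x ≡ᵇ_) xs)} dis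
      x∉ : ¬ Any.Any (x ≡_) xs
      x∉ x∈ = subst T (Equivalence.to T-not-≡ fresh) (any⁺ (x ≡ᵇ_) (Any.map (λ {y} → ≡⇒≡ᵇ x y) x∈))
  in ¬Any⇒All¬ xs x∉ ∷ distinct⇒Unique xs dis′

isDMPartition⇒IsDMPartition : ∀ n l → T (isDMPartition n l) → IsDMPartition n l
isDMPartition⇒IsDMPartition n l dm =
  let (inc , dm₁) = T-∧⁻ {increasing l} dm
      (pos , dm₂) = T-∧⁻ {positive l} dm₁
      (dis , w≡n) = T-∧⁻ {distinct (multiplicities l)} dm₂
  in record
    { ascending               = ascending l inc pos
    ; multiplicities-positive = positive⇒multiplicities-positive l pos
    ; multiplicities-unique   = distinct⇒Unique (multiplicities l) dis
    ; weight≡n                = ≡ᵇ⇒≡ (weight l) n w≡n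
    }
  where
  ascending : ∀ l → T (increasing l) → T (positive l) → Ascending 0 l
  ascending []            _   _   = []
  ascending ((p , m) ∷ l) inc pos =
    increasing⇒Ascending l (<ᵇ⇒< 0 p (proj₁ (T-∧⁻ {0 <ᵇ p} (proj₁ (T-∧⁻ {(0 <ᵇ p) ∧ (0 <ᵇ m)} pos))))) inc

gaps : ℕ → List (ℕ × ℕ) → List ℕ
gaps lo []            = []
gaps lo ((p , _) ∷ l) = (p ∸ lo) ∷ gaps p l

fromGaps : ℕ → List ℕ → List ℕ → List (ℕ × ℕ)
fromGaps lo (s ∷ ss) (m ∷ ms) = (lo + s , m) ∷ fromGaps (lo + s) ss ms
fromGaps _  _        _        = []

fromGaps-gaps : ∀ {lo l} → Ascending lo l → fromGaps lo (gaps lo l) (multiplicities l) ≡ l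
fromGaps-gaps [] = refl
fromGaps-gaps {lo} {(p , m) ∷ l} (lo<p ∷ asc) rewrite m+[n∸m]≡n (<⇒≤ lo<p) = cong ((p , m) ∷_) (fromGaps-gaps asc)

length-gaps : ∀ lo l → length (gaps lo l) ≡ length l
length-gaps lo []            = refl
length-gaps lo ((p , _) ∷ l) = cong suc (length-gaps p l)

gaps-positive : ∀ {lo l} → Ascending lo l → All (1 ≤_) (gaps lo l)
gaps-positive []           = []
gaps-positive (lo<p ∷ asc) = m<n⇒0<n∸m lo<p ∷ gaps-positive asc

positionWeights : ℕ → List ℕ
positionWeights = iterate suc 1

gapWeights : ℕ → List ℕ
gapWeights = applyDownFrom (triangle ∘ suc)

-- The i-th part of an ascending partition with parts above lo is at least lo + i.
dot-iterate≤weight : ∀ {lo l} j → j ≤ suc lo → Ascending lo l → dot (iterate suc j (length l)) (multiplicities l) ≤ weight l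
dot-iterate≤weight j _ [] = z≤n
dot-iterate≤weight {l = (p , m) ∷ l} j j≤1+lo (lo<p ∷ asc) =
  +-mono-≤ (≤-trans (*-monoˡ-≤ m j≤p) (≤-reflexive (*-comm p m))) (dot-iterate≤weight (suc j) (s≤s j≤p) asc)
  where
  j≤p = ≤-trans j≤1+lo lo<p

-- weight l = lo * Σ m + Σᵢ gapᵢ (mᵢ + ⋯ + m_r), and the suffix mᵢ, …, m_r of distinct
-- positive multiplicities sums to at least triangle (r - i + 1).
dot-gapWeights≤weight : ∀ {lo l} → Ascending lo l → All (1 ≤_) (multiplicities l) → Unique (multiplicities l) →
                        lo * sum (multiplicities l) + dot (gapWeights (length l)) (gaps lo l) ≤ weight l
dot-gapWeights≤weight {lo} [] _ _ = ≤-reflexive (cong (_+ 0) (*-zeroʳ lo))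
dot-gapWeights≤weight {lo} {(p , m) ∷ l} (lo<p ∷ asc) ms⁺@(_ ∷ ms⁺′) ms!@(_ ∷ ms!′) = begin
  lo * (m + S) + (triangle (suc (length l)) * g + D)
    ≤⟨ +-monoʳ-≤ (lo * (m + S)) (+-monoˡ-≤ D (*-monoˡ-≤ g suffix)) ⟩
  lo * (m + S) + ((m + S) * g + D)  ≡⟨ regroup lo g m S D ⟩
  m * (lo + g) + ((lo + g) * S + D) ≡⟨ cong (λ q → m * q + (q * S + D)) (m+[n∸m]≡n (<⇒≤ lo<p)) ⟩
  m * p + (p * S + D)               ≤⟨ +-monoʳ-≤ (m * p) (dot-gapWeights≤weight asc ms⁺′ ms!′) ⟩
  m * p + weight l                  ∎
  where
  open ≤-Reasoning
  S = sum (multiplicities l)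
  g = p ∸ lo
  D = dot (gapWeights (length l)) (gaps p l)
  suffix : triangle (suc (length l)) ≤ m + S
  suffix = subst (λ r → triangle (suc r) ≤ m + S) (length-map proj₂ l) (triangle≤sum (m ∷ multiplicities l) ms! ms⁺)
  regroup : ∀ lo g m S D → lo * (m + S) + ((m + S) * g + D) ≡ m * (lo + g) + ((lo + g) * S + D)
  regroup = solve-∀

length-iterate : ∀ {A : Set} (f : A → A) x r → length (iterate f x r) ≡ r
length-iterate f x zero    = refl
length-iterate f x (suc r) = cong suc (length-iterate f (f x) r)

iterate-suc-positive : ∀ j r → 1 ≤ j → All (1 ≤_) (iterate suc j r)
iterate-suc-positive j zero    _   = []
iterate-suc-positive j (suc r) 1≤j = 1≤j ∷ iterate-suc-positive (suc j) r (s≤s z≤n)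

gapWeights-positive : ∀ r → All (1 ≤_) (gapWeights r)
gapWeights-positive zero    = []
gapWeights-positive (suc r) = s≤s z≤n ∷ gapWeights-positive r

sum≤dot : ∀ ws xs → length xs ≡ length ws → All (1 ≤_) xs → sum ws ≤ dot ws xs
sum≤dot []       []       _   _           = z≤n
sum≤dot (w ∷ ws) (x ∷ xs) len (1≤x ∷ xs⁺) =
  +-mono-≤ (≤-trans (≤-reflexive (sym (*-identityʳ w))) (*-monoʳ-≤ w 1≤x)) (sum≤dot ws xs (suc-injective len) xs⁺)

6*sum-gapWeights : ∀ r → 6 * sum (gapWeights r) ≡ r * suc r * suc (suc r)
6*sum-gapWeights zero    = refl
6*sum-gapWeights (suc r) = begin
  6 * (triangle (suc r) + sum (gapWeights r))       ≡⟨ *-distribˡ-+ 6 (triangle (suc r)) _ ⟩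
  6 * triangle (suc r) + 6 * sum (gapWeights r)     ≡⟨ cong₂ _+_ (trans (*-assoc 3 2 (triangle (suc r))) (cong (3 *_) (2*triangle (suc r))))
                                                                 (6*sum-gapWeights r) ⟩
  3 * (suc r * suc (suc r)) + r * suc r * suc (suc r) ≡⟨ expand r ⟩
  suc r * suc (suc r) * suc (suc (suc r))           ∎
  where
  open ≡-Reasoning
  expand : ∀ r → 3 * (suc r * suc (suc r)) + r * suc r * suc (suc r) ≡ suc r * suc (suc r) * suc (suc (suc r))
  expand = solve-∀

candidates : ℕ → ℕ → List (List (ℕ × ℕ))
candidates n r = cartesianProductWith (fromGaps 0) (simplex (gapWeights r) n) (simplex (positionWeights r) n)

module _ {n l} (dm : IsDMPartition n l) where
  open IsDMPartition dm

  private
    r = length l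

    dot-gaps≤n : dot (gapWeights r) (gaps 0 l) ≤ n
    dot-gaps≤n = subst (dot (gapWeights r) (gaps 0 l) ≤_) weight≡n
                   (dot-gapWeights≤weight ascending multiplicities-positive multiplicities-unique)

    length-gaps≡ : length (gaps 0 l) ≡ length (gapWeights r)
    length-gaps≡ = trans (length-gaps 0 l) (sym (length-applyDownFrom _ r))

  ∈-candidates : l ∈ candidates n r
  ∈-candidates = subst (_∈ candidates n r) (fromGaps-gaps ascending) (∈-cartesianProductWith⁺ (fromGaps 0) gaps∈ ms∈)
    where
    gaps∈ : gaps 0 l ∈ simplex (gapWeights r) n
    gaps∈ = ∈-simplex (gapWeights r) (gaps 0 l) n length-gaps≡ (gapWeights-positive r) (gaps-positive ascending) dot-gaps≤n
    ms∈ : multiplicities l ∈ simplex (positionWeights r) n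
    ms∈ = ∈-simplex (positionWeights r) (multiplicities l) n
            (trans (length-map proj₂ l) (sym (length-iterate suc 1 r)))
            (iterate-suc-positive 1 r (s≤s z≤n)) multiplicities-positive
            (subst (dot (positionWeights r) (multiplicities l) ≤_) weight≡n (dot-iterate≤weight 1 (s≤s z≤n) ascending))

  length^3≤6n : r ^ 3 ≤ 6 * n
  length^3≤6n = begin
    r ^ 3                       ≤⟨ r^3≤r[r+1][r+2] ⟩
    r * suc r * suc (suc r)     ≡⟨ 6*sum-gapWeights r ⟨
    6 * sum (gapWeights r)      ≤⟨ *-monoʳ-≤ 6 (sum≤dot (gapWeights r) (gaps 0 l) length-gaps≡ (gaps-positive ascending)) ⟩
    6 * dot (gapWeights r) (gaps 0 l) ≤⟨ *-monoʳ-≤ 6 dot-gaps≤n ⟩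
    6 * n                       ∎
    where
    open ≤-Reasoning
    r^3≤r[r+1][r+2] : r * (r * (r * 1)) ≤ r * suc r * suc (suc r)
    r^3≤r[r+1][r+2] = begin
      r * (r * (r * 1)) ≡⟨ cong (λ x → r * (r * x)) (*-identityʳ r) ⟩
      r * (r * r)       ≡⟨ *-assoc r r r ⟨
      r * r * r         ≤⟨ *-mono-≤ (*-monoʳ-≤ r (n≤1+n r)) (≤-trans (n≤1+n r) (n≤1+n (suc r))) ⟩
      r * suc r * suc (suc r) ∎

candidatesUpTo : ℕ → ℕ → List (List (ℕ × ℕ))
candidatesUpTo n zero    = candidates n 0
candidatesUpTo n (suc y) = candidates n (suc y) ++ candidatesUpTo n y

∈-candidatesUpTo : ∀ n y {r l} → r ≤ y → l ∈ candidates n r → l ∈ candidatesUpTo n y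
∈-candidatesUpTo n zero    z≤n l∈ = l∈
∈-candidatesUpTo n (suc y) r≤y l∈ with m≤n⇒m<n∨m≡n r≤y
... | inj₁ r<1+y = ∈-++⁺ʳ (candidates n (suc y)) (∈-candidatesUpTo n y (≤-pred r<1+y) l∈)
... | inj₂ refl  = ∈-++⁺ˡ l∈

DMPartition-∈-candidatesUpTo : ∀ n y → 6 * n < suc y ^ 3 → ∀ l → T (isDMPartition n l) → l ∈ candidatesUpTo n y
DMPartition-∈-candidatesUpTo n y 6n<[1+y]³ l dm =
  ∈-candidatesUpTo n y {length l} (≤-pred (^-cancelʳ-< {length l} 3 (≤-<-trans (length^3≤6n dm′) 6n<[1+y]³))) (∈-candidates dm′)
  where
  dm′ = isDMPartition⇒IsDMPartition n l dm

count≤length : ∀ {n k} (L : List (List (ℕ × ℕ))) → (∀ l → T (isDMPartition n l) → l ∈ L) →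
               (Fin k ↔ DMPartition n) → k ≤ length L
count≤length {n} {k} L cover bij = injective⇒≤ {f = position} position-injective
  where
  open Inverse bij using (to; from; strictlyInverseʳ)
  position : Fin k → Fin (length L)
  position i = index (cover (proj₁ (to i)) (proj₂ (to i)))
  same-partition : ∀ {a b : DMPartition n} → proj₁ a ≡ proj₁ b → a ≡ b
  same-partition {l , p} {.l , q} refl = cong (l ,_) (T-irrelevant p q)
  position-injective : ∀ {i j} → position i ≡ position j → i ≡ j
  position-injective {i} {j} eq = begin
    i             ≡⟨ strictlyInverseʳ i ⟨
    from (to i)   ≡⟨ cong from (same-partition (begin
                       proj₁ (to i)                ≡⟨ lookup-index (cover _ (proj₂ (to i))) ⟩
                       lookup L (position i)       ≡⟨ cong (lookup L) eq ⟩
                       lookup L (position j)       ≡⟨ lookup-index (cover _ (proj₂ (to j))) ⟨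
                       proj₁ (to j)                ∎)) ⟩
    from (to j)   ≡⟨ strictlyInverseʳ j ⟩
    j             ∎
    where open ≡-Reasoning

length-cartesianProductWith : ∀ {A B C : Set} (f : A → B → C) xs ys →
                              length (cartesianProductWith f xs ys) ≡ length xs * length ys
length-cartesianProductWith f []       ys = refl
length-cartesianProductWith f (x ∷ xs) ys =
  trans (length-++ (map (f x) ys)) (cong₂ _+_ (length-map (f x) ys) (length-cartesianProductWith f xs ys))

product-iterate-suc : ∀ j r → product (iterate suc (suc j) r) * j ! ≡ (j + r) !
product-iterate-suc j zero    = trans (+-identityʳ (j !)) (cong _! (sym (+-identityʳ j)))
product-iterate-suc j (suc r) = begin
  suc j * product (iterate suc (2 + j) r) * j !  ≡⟨ *-CS.xy∙z≈y∙xz (suc j) (product (iterate suc (2 + j) r)) (j !) ⟩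
  product (iterate suc (2 + j) r) * (suc j) !    ≡⟨ product-iterate-suc (suc j) r ⟩
  (suc j + r) !                                  ≡⟨ cong _! (+-suc j r) ⟨
  (j + suc r) !                                  ∎
  where open ≡-Reasoning

product-positionWeights : ∀ r → product (positionWeights r) ≡ r !
product-positionWeights r = trans (sym (*-identityʳ _)) (product-iterate-suc 0 r)

2^r*product-gapWeights : ∀ r → 2 ^ r * product (gapWeights r) ≡ r ! * (suc r) !
2^r*product-gapWeights zero    = refl
2^r*product-gapWeights (suc r) = begin
  2 * 2 ^ r * (triangle (suc r) * product (gapWeights r))   ≡⟨ regroup (2 ^ r) (triangle (suc r)) _ ⟩
  2 * triangle (suc r) * (2 ^ r * product (gapWeights r))   ≡⟨ cong₂ _*_ (2*triangle (suc r)) (2^r*product-gapWeights r) ⟩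
  suc r * (2 + r) * (r ! * (suc r) !)                       ≡⟨ factorials (suc r) (r !) ⟩
  (suc r) ! * (2 + r) !                                     ∎
  where
  open ≡-Reasoning
  regroup : ∀ a t p → 2 * a * (t * p) ≡ 2 * t * (a * p)
  regroup = solve-∀
  factorials : ∀ s f → s * suc s * (f * (s * f)) ≡ s * f * (suc s * (s * f))
  factorials = solve-∀

denominator : ℕ → ℕ
denominator r = r ! * r ! * r ! * (r ! * (suc r) !)

numerator : ℕ → ℕ → ℕ
numerator n r = 2 ^ r * (n ^ r * n ^ r)

denominator≢0 : ∀ r → NonZero (denominator r)
denominator≢0 r = m*n≢0 _ _ {{m*n≢0 _ _ {{r !* r !≢0}} {{r !≢0}}}} {{r !* suc r !≢0}}

y!^5≤denominator : ∀ y → (y !) ^ 5 ≤ denominator y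
y!^5≤denominator y = begin
  (y !) ^ 5                           ≡⟨ fifth (y !) ⟩
  y ! * y ! * y ! * (y ! * y !)       ≤⟨ *-monoʳ-≤ (y ! * y ! * y !) (*-monoʳ-≤ (y !) (m≤n*m (y !) (suc y))) ⟩
  y ! * y ! * y ! * (y ! * (suc y) !) ∎
  where
  open ≤-Reasoning
  fifth : ∀ f → f * (f * (f * (f * (f * 1)))) ≡ f * f * f * (f * f)
  fifth = solve-∀

length-candidates : ∀ n r → length (candidates n r) * denominator r ≤ numerator n r
length-candidates n r = begin
  length (candidates n r) * denominator r
    ≡⟨ cong (_* denominator r) (length-cartesianProductWith (fromGaps 0) (simplex (gapWeights r) n) _) ⟩
  A * B * denominator r
    ≡⟨ cong (λ x → A * B * (r ! * r ! * r ! * x)) (2^r*product-gapWeights r) ⟨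
  A * B * (r ! * r ! * r ! * (2 ^ r * P))            ≡⟨ regroup A B (r !) (2 ^ r) P ⟩
  2 ^ r * ((A * (r ! * P)) * (B * (r ! * r !)))      ≤⟨ *-monoʳ-≤ (2 ^ r) (*-mono-≤ A-bound B-bound) ⟩
  2 ^ r * (n ^ r * n ^ r)                            ∎
  where
  open ≤-Reasoning
  A = length (simplex (gapWeights r) n)
  B = length (simplex (positionWeights r) n)
  P = product (gapWeights r)
  A-bound : A * (r ! * P) ≤ n ^ r
  A-bound = subst (λ d → A * (d ! * P) ≤ n ^ d) (length-applyDownFrom _ r)
              (length-simplex (gapWeights r) n (gapWeights-positive r))
  B-bound : B * (r ! * r !) ≤ n ^ r
  B-bound = subst₂ (λ d p → B * (d ! * p) ≤ n ^ d) (length-iterate suc 1 r) (product-positionWeights r)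
              (length-simplex (positionWeights r) n (iterate-suc-positive 1 r (s≤s z≤n)))
  regroup : ∀ A B f t P → A * B * (f * f * f * (t * P)) ≡ t * ((A * (f * P)) * (B * (f * f)))
  regroup = solve-∀

-- The bound for t + 1 parts is at least the bound for t parts, for every t < y.
BoundIncreasing : ℕ → ℕ → Set
BoundIncreasing n y = ∀ t → suc t ≤ y → suc t ^ 4 * (2 + t) ≤ 2 * n * n

denominator-suc : ∀ r → denominator (suc r) ≡ denominator r * (suc r ^ 4 * (2 + r))
denominator-suc r = regroup (suc r) (r !)
  where
  regroup : ∀ s f → s * f * (s * f) * (s * f) * (s * f * (suc s * (s * f)))
                  ≡ f * f * f * (f * (s * f)) * (s * (s * (s * (s * 1))) * suc s)
  regroup = solve-∀

numerator-suc : ∀ n r → numerator n (suc r) ≡ numerator n r * (2 * n * n)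
numerator-suc n r = regroup (2 ^ r) n (n ^ r)
  where
  regroup : ∀ t n a → 2 * t * (n * a * (n * a)) ≡ t * (a * a) * (2 * n * n)
  regroup = solve-∀

bound-monotone : ∀ n r y → r ≤ y → BoundIncreasing n y → numerator n r * denominator y ≤ numerator n y * denominator r
bound-monotone n r y r≤y increasing with m≤n⇒m<n∨m≡n r≤y
... | inj₂ refl = ≤-refl
bound-monotone n r (suc y) _ increasing | inj₁ r<1+y = begin
  numerator n r * denominator (suc y)          ≡⟨ cong (numerator n r *_) (denominator-suc y) ⟩
  numerator n r * (denominator y * c)          ≡⟨ *-assoc (numerator n r) (denominator y) c ⟨
  numerator n r * denominator y * c            ≤⟨ *-monoˡ-≤ c (bound-monotone n r y (≤-pred r<1+y) (λ t t<y → increasing t (m≤n⇒m≤1+n t<y))) ⟩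
  numerator n y * denominator r * c            ≤⟨ *-monoʳ-≤ (numerator n y * denominator r) (increasing y ≤-refl) ⟩
  numerator n y * denominator r * (2 * n * n)  ≡⟨ *-CS.xy∙z≈xz∙y (numerator n y) (denominator r) (2 * n * n) ⟩
  numerator n y * (2 * n * n) * denominator r  ≡⟨ cong (_* denominator r) (numerator-suc n y) ⟨
  numerator n (suc y) * denominator r          ∎
  where
  open ≤-Reasoning
  c = suc y ^ 4 * (2 + y)

length-candidates≤ : ∀ n r y → r ≤ y → BoundIncreasing n y → length (candidates n r) * denominator y ≤ numerator n y
length-candidates≤ n r y r≤y increasing = *-cancelʳ-≤ _ _ (denominator r) {{denominator≢0 r}} (begin
  length (candidates n r) * denominator y * denominator r ≡⟨ *-CS.xy∙z≈xz∙y (length (candidates n r)) (denominator y) _ ⟩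
  length (candidates n r) * denominator r * denominator y ≤⟨ *-monoˡ-≤ (denominator y) (length-candidates n r) ⟩
  numerator n r * denominator y                           ≤⟨ bound-monotone n r y r≤y increasing ⟩
  numerator n y * denominator r                           ∎)
  where open ≤-Reasoning

length-candidatesUpTo : ∀ n y Y → y ≤ Y → BoundIncreasing n Y → length (candidatesUpTo n y) * denominator Y ≤ suc y * numerator n Y
length-candidatesUpTo n zero    Y _   increasing =
  ≤-trans (length-candidates≤ n 0 Y z≤n increasing) (≤-reflexive (sym (+-identityʳ (numerator n Y))))
length-candidatesUpTo n (suc y) Y y<Y increasing = begin
  length (candidates n (suc y) ++ candidatesUpTo n y) * denominator Y
    ≡⟨ cong (_* denominator Y) (length-++ (candidates n (suc y))) ⟩
  (length (candidates n (suc y)) + length (candidatesUpTo n y)) * denominator Y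
    ≡⟨ *-distribʳ-+ (denominator Y) (length (candidates n (suc y))) _ ⟩
  length (candidates n (suc y)) * denominator Y + length (candidatesUpTo n y) * denominator Y
    ≤⟨ +-mono-≤ (length-candidates≤ n (suc y) Y y<Y increasing) (length-candidatesUpTo n y Y (≤-trans (n≤1+n y) y<Y) increasing) ⟩
  numerator n Y + suc y * numerator n Y ∎
  where open ≤-Reasoning

-- Asymptotics

floor-cbrt : ∀ M → ∃[ y ] (y ^ 3 ≤ M × M < suc y ^ 3)
floor-cbrt zero = 0 , z≤n , s≤s z≤n
floor-cbrt (suc M) with floor-cbrt M
... | y , y³≤M , M<[1+y]³ with suc y ^ 3 ≤? suc M
...   | yes [1+y]³≤1+M = suc y , [1+y]³≤1+M , ≤-<-trans M<[1+y]³ (^-monoˡ-< 3 (n<1+n (suc y)))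
...   | no  [1+y]³≰1+M = y , m≤n⇒m≤1+n y³≤M , ≰⇒> [1+y]³≰1+M

[2+y]^3≤2*[1+y]^3 : ∀ y → 3 ≤ y → (2 + y) ^ 3 ≤ 2 * (1 + y) ^ 3
[2+y]^3≤2*[1+y]^3 1 (s≤s ())
[2+y]^3≤2*[1+y]^3 2 (s≤s (s≤s ()))
[2+y]^3≤2*[1+y]^3 (suc (suc (suc t))) _ = ≤-trans (m≤m+n _ (t * (t * t) + 9 * (t * t) + 21 * t + 3)) (≤-reflexive (expand t))
  where
  expand : ∀ t → (5 + t) * ((5 + t) * ((5 + t) * 1)) + (t * (t * t) + 9 * (t * t) + 21 * t + 3)
               ≡ 2 * ((4 + t) * ((4 + t) * ((4 + t) * 1)))
  expand = solve-∀

2^30*[1+y]^3≤2^y : ∀ y → 61 ≤ y → 2 ^ 30 * suc y ^ 3 ≤ 2 ^ y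
2^30*[1+y]^3≤2^y y 61≤y = subst (λ y → 2 ^ 30 * suc y ^ 3 ≤ 2 ^ y) (m∸n+n≡m 61≤y) (from61 (y ∸ 61))
  where
  from61 : ∀ t → 2 ^ 30 * suc (t + 61) ^ 3 ≤ 2 ^ (t + 61)
  from61 zero    = ≤ᵇ⇒≤ (2 ^ 30 * 62 ^ 3) (2 ^ 61) _
  from61 (suc t) = begin
    2 ^ 30 * (2 + u) ^ 3       ≤⟨ *-monoʳ-≤ (2 ^ 30) ([2+y]^3≤2*[1+y]^3 u (≤-trans (s≤s (s≤s (s≤s z≤n))) (m≤n+m 61 t))) ⟩
    2 ^ 30 * (2 * (1 + u) ^ 3) ≡⟨ *-CS.x∙yz≈y∙xz (2 ^ 30) 2 ((1 + u) ^ 3) ⟩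
    2 * (2 ^ 30 * (1 + u) ^ 3) ≤⟨ *-monoʳ-≤ 2 (from61 t) ⟩
    2 * 2 ^ u                  ∎
    where
    open ≤-Reasoning
    u = t + 61

BoundIncreasing-below-cbrt : ∀ n y → 1 ≤ y → y ^ 3 ≤ 6 * n → 6 ^ 5 ≤ n → BoundIncreasing n y
BoundIncreasing-below-cbrt n y 1≤y y³≤6n 6⁵≤n t 1+t≤y = begin
  suc t ^ 4 * (2 + t) ≤⟨ *-mono-≤ (^-monoˡ-≤ 4 1+t≤y) (s≤s 1+t≤y) ⟩
  y ^ 4 * suc y       ≤⟨ *-monoʳ-≤ (y ^ 4) (+-monoˡ-≤ y 1≤y) ⟩
  y ^ 4 * (y + y)     ≡⟨ y⁴[y+y]≡2y⁵ y ⟩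
  2 * y ^ 5           ≤⟨ *-monoʳ-≤ 2 y⁵≤n² ⟩
  2 * n ^ 2           ≡⟨ *-assoc 2 n (n * 1) ⟨
  2 * n * (n * 1)     ≡⟨ cong (2 * n *_) (*-identityʳ n) ⟩
  2 * n * n           ∎
  where
  open ≤-Reasoning
  y⁴[y+y]≡2y⁵ : ∀ y → y * (y * (y * (y * 1))) * (y + y) ≡ 2 * (y * (y * (y * (y * (y * 1)))))
  y⁴[y+y]≡2y⁵ = solve-∀
  y⁵≤n² : y ^ 5 ≤ n ^ 2
  y⁵≤n² = ^-cancelʳ-≤ 3 (begin
    (y ^ 5) ^ 3  ≡⟨ [m^n]^o≡[m^o]^n y 5 3 ⟩
    (y ^ 3) ^ 5  ≤⟨ ^-monoˡ-≤ 5 y³≤6n ⟩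
    (6 * n) ^ 5  ≡⟨ ^-distribʳ-* 6 n 5 ⟩
    6 ^ 5 * n ^ 5 ≤⟨ *-monoˡ-≤ (n ^ 5) 6⁵≤n ⟩
    n ^ 6        ≡⟨ ^-*-assoc n 2 3 ⟨
    (n ^ 2) ^ 3  ∎)

[n^y]^5≤2^30*[y^y]^15 : ∀ n y → n ≤ suc y ^ 3 → (n ^ y) ^ 5 ≤ 2 ^ 30 * (y ^ y) ^ 15
[n^y]^5≤2^30*[y^y]^15 n y n≤[1+y]³ = begin
  (n ^ y) ^ 5           ≤⟨ ^-monoˡ-≤ 5 (^-monoˡ-≤ y n≤[1+y]³) ⟩
  ((suc y ^ 3) ^ y) ^ 5 ≡⟨ cong (_^ 5) ([m^n]^o≡[m^o]^n (suc y) 3 y) ⟩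
  ((suc y ^ y) ^ 3) ^ 5 ≤⟨ ^-monoˡ-≤ 5 (^-monoˡ-≤ 3 ([1+k]^k≤4*k^k y)) ⟩
  ((4 * y ^ y) ^ 3) ^ 5 ≡⟨ ^-*-assoc (4 * y ^ y) 3 5 ⟩
  (4 * y ^ y) ^ 15      ≡⟨ ^-distribʳ-* 4 (y ^ y) 15 ⟩
  2 ^ 30 * (y ^ y) ^ 15 ∎
  where open ≤-Reasoning

-- y! ≥ (y/4)^y and n ≤ (1 + y)^3 leave one factor n^(y/3) of the bound n^(2y) / y!^5.
cube-count-bound : ∀ n y k → 1 ≤ y → n ≤ suc y ^ 3 → k * denominator y ≤ suc y * numerator n y →
                   k ^ 3 ≤ 2 ^ 30 * suc y ^ 3 * (2 ^ y) ^ 33 * n ^ y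
cube-count-bound n y k 1≤y n≤[1+y]³ count = *-cancelʳ-≤ _ _ (U ^ 15) {{m^n≢0 U 15 {{m^n≢0 y y {{>-nonZero 1≤y}}}}}} (begin
  k ^ 3 * U ^ 15                   ≡⟨ cong (k ^ 3 *_) (^-*-assoc U 5 3) ⟨
  k ^ 3 * (U ^ 5) ^ 3              ≡⟨ ^-distribʳ-* k (U ^ 5) 3 ⟨
  (k * U ^ 5) ^ 3                  ≤⟨ ^-monoˡ-≤ 3 k*U⁵≤ ⟩
  (suc y * X ^ 11 * V ^ 2) ^ 3     ≡⟨ [m*n*o]^p≡m^p*n^p*o^p (suc y) (X ^ 11) (V ^ 2) 3 ⟩
  suc y ^ 3 * (X ^ 11) ^ 3 * (V ^ 2) ^ 3 ≡⟨ cong₂ (λ a b → suc y ^ 3 * a * b) (^-*-assoc X 11 3) (^-*-assoc V 2 3) ⟩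
  suc y ^ 3 * X ^ 33 * (V * V ^ 5) ≡⟨ *-assoc (suc y ^ 3 * X ^ 33) V (V ^ 5) ⟨
  suc y ^ 3 * X ^ 33 * V * V ^ 5   ≤⟨ *-monoʳ-≤ (suc y ^ 3 * X ^ 33 * V) ([n^y]^5≤2^30*[y^y]^15 n y n≤[1+y]³) ⟩
  suc y ^ 3 * X ^ 33 * V * (2 ^ 30 * U ^ 15) ≡⟨ regroup (suc y ^ 3) (X ^ 33) V (U ^ 15) (2 ^ 30) ⟩
  2 ^ 30 * suc y ^ 3 * X ^ 33 * V * U ^ 15 ∎)
  where
  open ≤-Reasoning
  U = y ^ y
  X = 2 ^ y
  V = n ^ y
  k*U⁵≤ : k * U ^ 5 ≤ suc y * X ^ 11 * V ^ 2
  k*U⁵≤ = begin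
    k * U ^ 5                         ≤⟨ *-monoʳ-≤ k (^-monoˡ-≤ 5 (≤-trans (k^k≤4^k*k! y) (≤-reflexive (cong (_* y !) (^-distribʳ-* 2 2 y))))) ⟩
    k * (X * X * y !) ^ 5             ≡⟨ cong (k *_) ([m*n*o]^p≡m^p*n^p*o^p X X (y !) 5) ⟩
    k * (X ^ 5 * X ^ 5 * (y !) ^ 5)   ≡⟨ cong (λ x → k * (x * (y !) ^ 5)) (^-distribˡ-+-* X 5 5) ⟨
    k * (X ^ 10 * (y !) ^ 5)          ≡⟨ *-CS.x∙yz≈y∙xz k (X ^ 10) ((y !) ^ 5) ⟩
    X ^ 10 * (k * (y !) ^ 5)          ≤⟨ *-monoʳ-≤ (X ^ 10) (≤-trans (*-monoʳ-≤ k (y!^5≤denominator y)) count) ⟩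
    X ^ 10 * (suc y * numerator n y)  ≡⟨ collect (suc y) X (X ^ 10) V ⟩
    suc y * X ^ 11 * V ^ 2            ∎
    where
    collect : ∀ s X A V → A * (s * (X * (V * V))) ≡ s * (X * A) * (V * (V * 1))
    collect = solve-∀
  regroup : ∀ a b v w c → a * b * v * (c * w) ≡ c * a * b * v * w
  regroup = solve-∀

DMPartition-count-cubed : ∀ n k y → 61 ^ 3 ≤ n → y ^ 3 ≤ 6 * n → 6 * n < suc y ^ 3 →
                          (Fin k ↔ DMPartition n) → k ^ 3 ≤ (2 ^ y) ^ 34 * n ^ y
DMPartition-count-cubed n k y 61³≤n y³≤6n 6n<[1+y]³ bij =
  ≤-trans (cube-count-bound n y k 1≤y (<⇒≤ n<[1+y]³) count)
          (*-monoˡ-≤ (n ^ y) (*-monoˡ-≤ ((2 ^ y) ^ 33) (2^30*[1+y]^3≤2^y y 61≤y)))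
  where
  n<[1+y]³ : n < suc y ^ 3
  n<[1+y]³ = ≤-<-trans (m≤n*m n 6) 6n<[1+y]³
  61≤y : 61 ≤ y
  61≤y = ≤-pred (^-cancelʳ-< 3 (≤-<-trans 61³≤n n<[1+y]³))
  1≤y : 1 ≤ y
  1≤y = ≤-trans (s≤s z≤n) 61≤y
  count : k * denominator y ≤ suc y * numerator n y
  count = ≤-trans (*-monoˡ-≤ (denominator y) (count≤length _ (DMPartition-∈-candidatesUpTo n y 6n<[1+y]³) bij))
                  (length-candidatesUpTo n y y ≤-refl
                    (BoundIncreasing-below-cbrt n y 1≤y y³≤6n (≤-trans (≤ᵇ⇒≤ (6 ^ 5) (61 ^ 3) _) 61³≤n)))

exponent-bound : ∀ a b n p q y → y ^ 3 ≤ 6 * n → 6 * n * ((b + a) ^ 3 * q ^ 3) < 27 * (p ^ 3 * b ^ 3) →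
                 y * (b + a) * q ≤ p * (3 * b)
exponent-bound a b n p q y y³≤6n hyp = <⇒≤ (^-cancelʳ-< 3 (begin-strict
  (y * (b + a) * q) ^ 3         ≡⟨ [m*n*o]^p≡m^p*n^p*o^p y (b + a) q 3 ⟩
  y ^ 3 * (b + a) ^ 3 * q ^ 3   ≤⟨ *-monoˡ-≤ (q ^ 3) (*-monoˡ-≤ ((b + a) ^ 3) y³≤6n) ⟩
  6 * n * (b + a) ^ 3 * q ^ 3   ≡⟨ *-assoc (6 * n) ((b + a) ^ 3) (q ^ 3) ⟩
  6 * n * ((b + a) ^ 3 * q ^ 3) <⟨ hyp ⟩
  27 * (p ^ 3 * b ^ 3)          ≡⟨ *-CS.x∙yz≈y∙xz 27 (p ^ 3) (b ^ 3) ⟩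
  p ^ 3 * (27 * b ^ 3)          ≡⟨ cong (p ^ 3 *_) (^-distribʳ-* 3 b 3) ⟨
  p ^ 3 * (3 * b) ^ 3           ≡⟨ ^-distribʳ-* p (3 * b) 3 ⟨
  (p * (3 * b)) ^ 3             ∎))
  where open ≤-Reasoning

-- For n ≥ 2^(34 b) the factor (2^y)^34 is at most n^(y a / b), so k^(3 b) ≤ n^(y (b + a)).
power-bound : ∀ a b n p q k y → 0 < a → 0 < b → 2 ^ (34 * b) ≤ n → y ^ 3 ≤ 6 * n →
              k ^ 3 ≤ (2 ^ y) ^ 34 * n ^ y → 6 * n * ((b + a) ^ 3 * q ^ 3) < 27 * (p ^ 3 * b ^ 3) → k ^ q ≤ n ^ p
power-bound a b n p q k y 0<a 0<b 2^34b≤n y³≤6n k³≤ hyp = ^-cancelʳ-≤ (3 * b) {{m*n≢0 3 b {{_}} {{>-nonZero 0<b}}}} (begin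
  (k ^ q) ^ (3 * b)             ≡⟨ [m^n]^o≡[m^o]^n k q (3 * b) ⟩
  (k ^ (3 * b)) ^ q             ≤⟨ ^-monoˡ-≤ q k^3b≤ ⟩
  (n ^ (y * (b + a))) ^ q       ≡⟨ ^-*-assoc n (y * (b + a)) q ⟩
  n ^ (y * (b + a) * q)         ≤⟨ ^-monoʳ-≤ n {{n≢0}} (exponent-bound a b n p q y y³≤6n hyp) ⟩
  n ^ (p * (3 * b))             ≡⟨ ^-*-assoc n p (3 * b) ⟨
  (n ^ p) ^ (3 * b)             ∎)
  where
  open ≤-Reasoning
  1≤n : 1 ≤ n
  1≤n = ≤-trans (m^n>0 2 (34 * b)) 2^34b≤n
  n≢0 : NonZero n
  n≢0 = >-nonZero 1≤n
  V = n ^ y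
  V≢0 : NonZero V
  V≢0 = m^n≢0 n y {{n≢0}}
  [2^y]^34b≤V^a : ((2 ^ y) ^ 34) ^ b ≤ V ^ a
  [2^y]^34b≤V^a = begin
    ((2 ^ y) ^ 34) ^ b  ≡⟨ ^-*-assoc (2 ^ y) 34 b ⟩
    (2 ^ y) ^ (34 * b)  ≡⟨ [m^n]^o≡[m^o]^n 2 y (34 * b) ⟩
    (2 ^ (34 * b)) ^ y  ≤⟨ ^-monoˡ-≤ y 2^34b≤n ⟩
    V                   ≤⟨ m≤m^n V a {{V≢0}} {{>-nonZero 0<a}} ⟩
    V ^ a               ∎
  k^3b≤ : k ^ (3 * b) ≤ n ^ (y * (b + a))
  k^3b≤ = begin
    k ^ (3 * b)               ≡⟨ ^-*-assoc k 3 b ⟨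
    (k ^ 3) ^ b               ≤⟨ ^-monoˡ-≤ b k³≤ ⟩
    ((2 ^ y) ^ 34 * V) ^ b    ≡⟨ ^-distribʳ-* ((2 ^ y) ^ 34) V b ⟩
    ((2 ^ y) ^ 34) ^ b * V ^ b ≤⟨ *-monoˡ-≤ (V ^ b) [2^y]^34b≤V^a ⟩
    V ^ a * V ^ b             ≡⟨ *-comm (V ^ a) (V ^ b) ⟩
    V ^ b * V ^ a             ≡⟨ ^-distribˡ-+-* V b a ⟨
    V ^ (b + a)               ≡⟨ ^-*-assoc n y (b + a) ⟩
    n ^ (y * (b + a))         ∎

lemma2 : (a b : ℕ) → 0 < a → 0 < b →
    ∃[ N ] ((n : ℕ) → N ≤ n → (p q k : ℕ) → 0 < q →
      (Fin k ↔ DMPartition n) →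
      6 * n * ((b + a) ^ 3 * q ^ 3) < 27 * (p ^ 3 * b ^ 3) →
      k ^ q ≤ n ^ p)
lemma2 a b 0<a 0<b = 61 ^ 3 + 2 ^ (34 * b) , bound
  where
  bound : ∀ n → 61 ^ 3 + 2 ^ (34 * b) ≤ n → ∀ p q k → 0 < q → (Fin k ↔ DMPartition n) →
          6 * n * ((b + a) ^ 3 * q ^ 3) < 27 * (p ^ 3 * b ^ 3) → k ^ q ≤ n ^ p
  bound n N≤n p q k _ bij hyp =
    let (y , y³≤6n , 6n<[1+y]³) = floor-cbrt (6 * n) in
    power-bound a b n p q k y 0<a 0<b (m+n≤o⇒n≤o (61 ^ 3) {2 ^ (34 * b)} {n} N≤n) y³≤6n
      (DMPartition-count-cubed n k y (m+n≤o⇒m≤o (61 ^ 3) {2 ^ (34 * b)} {n} N≤n) y³≤6n 6n<[1+y]³ bij) hyp
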